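{- Let $M_1,M_2$ be matroids on ground sets $E_1,E_2$ with $E_1\cap E_2=X$, such that $M_1|X=M_2|X$, $X$ is a modular flat of $M_2$, and $M_2|X\cong U_{2,n}$ for some $n\ge 2$. A subset $H\subseteq E_1\cup E_2$ is a hyperplane of $P_X(M_1,M_2)$ if and only if one of the following holds: (1) $E_1\subseteq H$ and $H\cap E_2$ is a hyperplane of $M_2$ containing $X$; (2) $E_2\subseteq H$ and $H\cap E_1$ is a hyperplane of $M_1$ containing $X$; (3) $H\cap E_i$ is a hyperplane of $M_i$ for $i=1,2$ and $|H\cap X|=1$; (4) $H\cap E_1$ is a hyperplane of $M_1$ disjoint from $X$, and $H\cap E_2$ is a corank-2 flat of $M_2$ disjoint from $X$.
   Context: A flat $T$ of a matroid $N$ with rank function $r$ is modular if $r(T)+r(F)=r(T\cap F)+r(T\cup F)$ for every flat $F$ of $N$. If $M_1|X=M_2|X$ and $X$ is a modular flat of at least one of $M_1,M_2$, the generalized parallel connection $P_X(M_1,M_2)$ is the matroid on $E_1\cup E_2$ whose flats are exactly the sets $F$ with $F\cap E_i$ a flat of $M_i$ for $i=1,2$. $U_{2,n}$ is the uniform matroid of rank $2$ on $n$ elements. -}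

module Defs where

open import Data.Nat using (ℕ; _+_; _≤_; _<_; _⊓_)
open import Data.Fin using (Fin; _≟_)
open import Data.Fin.Subset using (Subset; _∈_; _∉_; _⊆_; _∩_; _∪_; ⁅_⁆; ∣_∣)
open import Data.Fin.Subset.Properties using (_∈?_)
open import Data.Fin.Properties using (any?)
open import Data.Vec using (tabulate)
open import Data.Product using (Σ; _×_; _,_)
open import Relation.Nullary using (does)
open import Relation.Nullary.Decidable using (_×-dec_)
open import Relation.Binary.PropositionalEquality using (_≡_)
open import Function.Definitions using (Injective)
open import Function.Bundles using (_⇔_)

-- A (finite) matroid whose ground set E is a subset of the universe Fin m,
-- given by its rank function (axioms R1–R3, imposed on subsets of E).
record Matroid (m : ℕ) : Set where
  field
    E        : Subset m
    r        : Subset m → ℕ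
    r-bound  : ∀ A → A ⊆ E → r A ≤ ∣ A ∣
    r-mono   : ∀ A B → A ⊆ B → B ⊆ E → r A ≤ r B
    r-submod : ∀ A B → A ⊆ E → B ⊆ E → r (A ∪ B) + r (A ∩ B) ≤ r A + r B
open Matroid public

module _ {m : ℕ} (M : Matroid m) where
  Flat : Subset m → Set
  Flat F = F ⊆ E M × (∀ e → e ∈ E M → e ∉ F → r M F < r M (F ∪ ⁅ e ⁆))

  ModularFlat : Subset m → Set
  ModularFlat T = Flat T × (∀ F → Flat F → r M T + r M F ≡ r M (T ∩ F) + r M (T ∪ F))

  Hyperplane : Subset m → Set
  Hyperplane H = Flat H × (r M H + 1 ≡ r M (E M))

  Corank2Flat : Subset m → Set
  Corank2Flat F = Flat F × (r M F + 2 ≡ r M (E M))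

SameRestriction : ∀ {m} → Matroid m → Matroid m → Subset m → Set
SameRestriction M₁ M₂ X = X ⊆ E M₁ × X ⊆ E M₂ × (∀ A → A ⊆ X → r M₁ A ≡ r M₂ A)

image : ∀ {n m} → (Fin n → Fin m) → Subset n → Subset m
image f A = tabulate λ j → does (any? λ i → (i ∈? A) ×-dec (f i ≟ j))

uniformRank : (k : ℕ) {n : ℕ} → Subset n → ℕ
uniformRank k A = ∣ A ∣ ⊓ k

RestrictionIsoUniform : ∀ {m} → Matroid m → Subset m → (k n : ℕ) → Set
RestrictionIsoUniform {m} M X k n =
  X ⊆ E M ×
  Σ (Fin n → Fin m) λ f →
    Injective _≡_ _≡_ f × image f (Data.Fin.Subset.⊤) ≡ X ×
    (∀ (A : Subset n) → r M (image f A) ≡ uniformRank k A)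
  where import Data.Fin.Subset

-- P is the generalized parallel connection P_X(M1,M2): its ground set is
-- E1 ∪ E2 and its flats are exactly the F ⊆ E1 ∪ E2 with F ∩ Ei a flat of Mi.
IsGenParallelConnection : ∀ {m} → Matroid m → Matroid m → Subset m → Matroid m → Set
IsGenParallelConnection M₁ M₂ X P =
  E P ≡ E M₁ ∪ E M₂ ×
  (∀ F → Flat P F ⇔ (F ⊆ E M₁ ∪ E M₂ × Flat M₁ (F ∩ E M₁) × Flat M₂ (F ∩ E M₂)))

-- Hyperplanes are exactly the maximal proper flats, and a flat of P_X(M₁,M₂) is a union G ∪ C of
-- flats of M₁ and M₂ that agree on X. To see that a piece H ∩ Eᵢ of a hyperplane H is maximal in Mᵢ,
-- glue a larger flat of Mᵢ to a suitable flat of the other side (its whole ground set, H ∩ Eⱼ, or a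
-- closure) and use the maximality of H. As X is a simple line, a flat containing two points of X
-- contains X, so H contains X (cases 1, 2), meets it in one point (case 3) or misses it (case 4).
-- In the last case modularity gives r(X ∪ F) = 2 + r(F) for flats F of M₂ disjoint from X, which
-- makes H ∩ E₂ a flat of corank 2.

module Submission where

open import Defs
open import Data.Nat using (ℕ; suc; _+_; _≤_; _<_; _≤?_)
import Data.Nat.Properties as ℕ
open import Data.Fin using (Fin; _≟_)
open import Data.Fin.Properties using (any?)
open import Data.Fin.Subset using (Subset; _∈_; _∉_; _⊆_; _∩_; _∪_; ⁅_⁆; ∁; ⊤; ⊥; ∣_∣; Empty; Nonempty)
import Data.Fin.Subset.Properties as SP
open import Data.Fin.Subset.Properties using (_∈?_; _⊆?_; nonempty?)
import Data.Vec.Properties as Vec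
open import Data.Product using (∃; _×_; _,_; proj₁; proj₂)
open import Data.Sum using (_⊎_; inj₁; inj₂; [_,_]′)
import Data.Sum as Sum
open import Data.Empty using (⊥-elim)
open import Function using (id; _∘_)
open import Function.Bundles using (_⇔_; mk⇔; Equivalence)
open import Relation.Nullary using (¬_; yes; no; ¬?)
open import Relation.Nullary.Decidable using (_×-dec_; decidable-stable)
open import Relation.Binary.PropositionalEquality using (_≡_; _≢_; refl; sym; trans; cong; subst)

private
  variable
    m n : ℕ
    x y z : Fin m
    p q s F G H C : Subset m

∈-∩⁺ : x ∈ p → x ∈ q → x ∈ p ∩ q
∈-∩⁺ x∈p x∈q = SP.x∈p∩q⁺ (x∈p , x∈q)

∈-∩⁻ˡ : x ∈ p ∩ q → x ∈ p
∈-∩⁻ˡ {p = p} {q} x∈ = proj₁ (SP.x∈p∩q⁻ p q x∈)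

∈-∩⁻ʳ : x ∈ p ∩ q → x ∈ q
∈-∩⁻ʳ {p = p} {q} x∈ = proj₂ (SP.x∈p∩q⁻ p q x∈)

∈-∪⁺ˡ : x ∈ p → x ∈ p ∪ q
∈-∪⁺ˡ x∈p = SP.x∈p∪q⁺ (inj₁ x∈p)

∈-∪⁺ʳ : x ∈ q → x ∈ p ∪ q
∈-∪⁺ʳ x∈q = SP.x∈p∪q⁺ (inj₂ x∈q)

∈-∪⁻ : x ∈ p ∪ q → x ∈ p ⊎ x ∈ q
∈-∪⁻ {p = p} {q} = SP.x∈p∪q⁻ p q

⊆-∩⁺ : p ⊆ q → p ⊆ s → p ⊆ q ∩ s
⊆-∩⁺ p⊆q p⊆s x∈p = ∈-∩⁺ (p⊆q x∈p) (p⊆s x∈p)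

∩-monoˡ : p ⊆ q → p ∩ s ⊆ q ∩ s
∩-monoˡ p⊆q x∈ = ∈-∩⁺ (p⊆q (∈-∩⁻ˡ x∈)) (∈-∩⁻ʳ x∈)

Empty-⊆ : p ⊆ q → Empty q → Empty p
Empty-⊆ p⊆q q-empty (x , x∈p) = q-empty (x , p⊆q x∈p)

∪-least : p ⊆ s → q ⊆ s → p ∪ q ⊆ s
∪-least p⊆s q⊆s x∈ = [ p⊆s , q⊆s ]′ (∈-∪⁻ x∈)

⁅⁆-⊆ : x ∈ p → ⁅ x ⁆ ⊆ p
⁅⁆-⊆ {x = x} {p} x∈p y∈⁅x⁆ = subst (_∈ p) (sym (SP.x∈⁅y⁆⇒x≡y x y∈⁅x⁆)) x∈p

⊈⇒∃∉ : ¬ p ⊆ q → ∃ λ x → x ∈ p × x ∉ q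
⊈⇒∃∉ {p = p} {q} p⊈q with any? (λ x → (x ∈? p) ×-dec ¬? (x ∈? q))
... | yes found = found
... | no none = ⊥-elim (p⊈q λ {x} x∈p → decidable-stable (x ∈? q) (λ x∉q → none (x , x∈p , x∉q)))

∣p∣≡1 : x ∈ p → (∀ {z} → z ∈ p → z ≡ x) → ∣ p ∣ ≡ 1
∣p∣≡1 {x = x} {p} x∈p only = trans (cong ∣_∣ p≡⁅x⁆) (SP.∣⁅x⁆∣≡1 x)
  where
  p≡⁅x⁆ : p ≡ ⁅ x ⁆
  p≡⁅x⁆ = SP.⊆-antisym (λ z∈p → subst (_∈ ⁅ x ⁆) (sym (only z∈p)) (SP.x∈⁅x⁆ x)) (⁅⁆-⊆ x∈p)

∪-∩-absorbʳ : p ⊆ s → (∀ {x} → x ∈ q → x ∈ s → x ∈ p) → (p ∪ q) ∩ s ≡ p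
∪-∩-absorbʳ p⊆s q∩s⊆p = SP.⊆-antisym
  (λ x∈ → [ id , (λ x∈q → q∩s⊆p x∈q (∈-∩⁻ʳ x∈)) ]′ (∈-∪⁻ (∈-∩⁻ˡ x∈)))
  (λ x∈p → ∈-∩⁺ (∈-∪⁺ˡ x∈p) (p⊆s x∈p))

∈-image⁻ : ∀ (f : Fin n → Fin m) {A : Subset n} → x ∈ image f A → ∃ λ i → i ∈ A × f i ≡ x
∈-image⁻ {x = x} f {A} x∈
  with any? (λ i → (i ∈? A) ×-dec (f i ≟ x)) | trans (sym (Vec.lookup∘tabulate _ x)) (Vec.[]=⇒lookup x∈)
... | yes found | _ = found
... | no _      | ()

image-⊆ : ∀ (f : Fin n → Fin m) {A : Subset n} → (∀ {i} → i ∈ A → f i ∈ p) → image f A ⊆ p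
image-⊆ {p = p} f f[A]⊆p x∈ with ∈-image⁻ f x∈
... | i , i∈A , fi≡x = subst (_∈ p) fi≡x (f[A]⊆p i∈A)

record IsMaximalFlat (M : Matroid m) (H : Subset m) : Set where
  field
    isFlat  : Flat M H
    proper  : ∃ λ x → x ∈ E M × x ∉ H
    maximal : ∀ F → Flat M F → H ⊆ F → F ⊆ H ⊎ E M ⊆ F

record Closure (M : Matroid m) (p : Subset m) : Set where
  field
    cl      : Subset m
    cl-flat : Flat M cl
    ⊆cl     : p ⊆ cl
    r-cl    : r M cl ≡ r M p

module MatroidProperties {m} (M : Matroid m) where

  r-∅ : r M ⊥ ≡ 0
  r-∅ = ℕ.n≤0⇒n≡0 (subst (r M ⊥ ≤_) (SP.∣⊥∣≡0 m) (r-bound M ⊥ (SP.⊆-min (E M))))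

  r-insert : p ⊆ E M → x ∈ E M → r M (p ∪ ⁅ x ⁆) ≤ suc (r M p)
  r-insert {p = p} {x} p⊆E x∈E = begin
    r M (p ∪ ⁅ x ⁆)                     ≤⟨ ℕ.m≤m+n _ _ ⟩
    r M (p ∪ ⁅ x ⁆) + r M (p ∩ ⁅ x ⁆)   ≤⟨ r-submod M p ⁅ x ⁆ p⊆E (⁅⁆-⊆ x∈E) ⟩
    r M p + r M ⁅ x ⁆                   ≤⟨ ℕ.+-monoʳ-≤ (r M p) r⁅x⁆≤1 ⟩
    r M p + 1                           ≡⟨ ℕ.+-comm (r M p) 1 ⟩
    suc (r M p)                         ∎
    where
    open ℕ.≤-Reasoning
    r⁅x⁆≤1 : r M ⁅ x ⁆ ≤ 1
    r⁅x⁆≤1 = subst (r M ⁅ x ⁆ ≤_) (SP.∣⁅x⁆∣≡1 x) (r-bound M ⁅ x ⁆ (⁅⁆-⊆ x∈E))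

  r-∪-modular-disjoint : ModularFlat M p → Flat M q → Empty (p ∩ q) → r M (p ∪ q) ≡ r M p + r M q
  r-∪-modular-disjoint {p = p} {q} (_ , modular) flq p∩q-empty = sym (begin
    r M p + r M q                 ≡⟨ modular q flq ⟩
    r M (p ∩ q) + r M (p ∪ q)     ≡⟨ cong (λ t → r M t + r M (p ∪ q)) (SP.Empty-unique p∩q-empty) ⟩
    r M ⊥ + r M (p ∪ q)           ≡⟨ cong (_+ r M (p ∪ q)) r-∅ ⟩
    r M (p ∪ q)                   ∎)
    where open Relation.Binary.PropositionalEquality.≡-Reasoning

  E-flat : Flat M (E M)
  E-flat = id , λ x x∈E x∉E → ⊥-elim (x∉E x∈E)

  flat-r-< : Flat M p → p ⊆ q → q ⊆ E M → x ∈ q → x ∉ p → r M p < r M q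
  flat-r-< {q = q} (_ , flp) p⊆q q⊆E x∈q x∉p =
    ℕ.<-≤-trans (flp _ (q⊆E x∈q) x∉p) (r-mono M _ q (∪-least p⊆q (⁅⁆-⊆ x∈q)) q⊆E)

  flat-absorbs : Flat M p → p ⊆ q → q ⊆ E M → r M q ≤ r M p → q ⊆ p
  flat-absorbs {p = p} flp p⊆q q⊆E rq≤rp {x} x∈q =
    decidable-stable (x ∈? p) (λ x∉p → ℕ.<⇒≱ (flat-r-< flp p⊆q q⊆E x∈q x∉p) rq≤rp)

  flat-absorbs-∩ : Flat M p → q ⊆ E M → r M q ≤ r M (p ∩ q) → q ⊆ p
  flat-absorbs-∩ {p = p} {q} flp q⊆E rq≤ x∈q =
    flat-absorbs flp ∈-∪⁺ˡ p∪q⊆E r-∪≤ (∈-∪⁺ʳ x∈q)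
    where
    open ℕ.≤-Reasoning
    p∪q⊆E : p ∪ q ⊆ E M
    p∪q⊆E = ∪-least (proj₁ flp) q⊆E
    r-∪≤ : r M (p ∪ q) ≤ r M p
    r-∪≤ = ℕ.+-cancelʳ-≤ (r M (p ∩ q)) _ _ (begin
      r M (p ∪ q) + r M (p ∩ q)   ≤⟨ r-submod M p q (proj₁ flp) q⊆E ⟩
      r M p + r M q               ≤⟨ ℕ.+-monoʳ-≤ (r M p) rq≤ ⟩
      r M p + r M (p ∩ q)         ∎)

  private
    ∣∁∪⁅⁆∣< : x ∉ p → ∣ ∁ (p ∪ ⁅ x ⁆) ∣ < ∣ ∁ p ∣
    ∣∁∪⁅⁆∣< {x = x} x∉p = SP.p⊂q⇒∣p∣<∣q∣
      ( (λ y∈ → SP.x∉p⇒x∈∁p (SP.x∈∁p⇒x∉p y∈ ∘ ∈-∪⁺ˡ))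
      , x , SP.x∉p⇒x∈∁p x∉p , λ x∈ → SP.x∈∁p⇒x∉p x∈ (∈-∪⁺ʳ (SP.x∈⁅x⁆ x)))

    -- Adds elements that do not raise the rank; each addition shrinks ∁ p, which bounds the fuel.
    closure-fuel : ∀ k → ∣ ∁ p ∣ < k → p ⊆ E M → Closure M p
    closure-fuel {p = p} (suc k) ∣∁p∣<k p⊆E
      with any? (λ x → (x ∈? E M) ×-dec ¬? (x ∈? p) ×-dec (r M (p ∪ ⁅ x ⁆) ≤? r M p))
    ... | no none = record
      { cl = p ; cl-flat = p⊆E , (λ x x∈E x∉p → ℕ.≰⇒> (λ le → none (x , x∈E , x∉p , le)))
      ; ⊆cl = id ; r-cl = refl }
    ... | yes (x , x∈E , x∉p , r≤) = record
      { cl = cl ; cl-flat = cl-flat ; ⊆cl = λ y∈p → ⊆cl (∈-∪⁺ˡ y∈p)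
      ; r-cl = trans r-cl (ℕ.≤-antisym r≤ (r-mono M _ _ ∈-∪⁺ˡ p+x⊆E)) }
      where
      p+x⊆E = ∪-least p⊆E (⁅⁆-⊆ x∈E)
      open Closure (closure-fuel k (ℕ.<-≤-trans (∣∁∪⁅⁆∣< x∉p) (ℕ.≤-pred ∣∁p∣<k)) p+x⊆E)

  closure : p ⊆ E M → Closure M p
  closure = closure-fuel _ (ℕ.n<1+n _)

  hyperplane⇒maximal : Hyperplane M p → IsMaximalFlat M p
  hyperplane⇒maximal {p = H} (flH , rH+1≡rE) = record
    { isFlat = flH ; proper = ⊈⇒∃∉ E⊈H ; maximal = maximal }
    where
    1+rH≡rE : suc (r M H) ≡ r M (E M)
    1+rH≡rE = trans (ℕ.+-comm 1 (r M H)) rH+1≡rE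
    E⊈H : ¬ E M ⊆ H
    E⊈H E⊆H = ℕ.<⇒≱ (ℕ.≤-reflexive 1+rH≡rE) (r-mono M _ _ E⊆H (proj₁ flH))
    maximal : ∀ F → Flat M F → H ⊆ F → F ⊆ H ⊎ E M ⊆ F
    maximal F flF H⊆F with F ⊆? H
    ... | yes F⊆H = inj₁ F⊆H
    ... | no F⊈H with ⊈⇒∃∉ F⊈H
    ... | x , x∈F , x∉H = inj₂ (flat-absorbs flF (proj₁ flF) id
            (subst (_≤ r M F) 1+rH≡rE (flat-r-< flH H⊆F (proj₁ flF) x∈F x∉H)))

  maximal⇒hyperplane : IsMaximalFlat M p → Hyperplane M p
  maximal⇒hyperplane {p = H} record { isFlat = flH ; proper = x , x∈E , x∉H ; maximal = maximal } =
    flH , trans (ℕ.+-comm (r M H) 1) (ℕ.≤-antisym lower upper)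
    where
    open ℕ.≤-Reasoning
    H+x⊆E = ∪-least (proj₁ flH) (⁅⁆-⊆ x∈E)
    open Closure (closure H+x⊆E)
    lower : suc (r M H) ≤ r M (E M)
    lower = ℕ.≤-trans (proj₂ flH x x∈E x∉H) (r-mono M _ _ H+x⊆E id)
    upper : r M (E M) ≤ suc (r M H)
    upper with maximal cl cl-flat (λ y∈H → ⊆cl (∈-∪⁺ˡ y∈H))
    ... | inj₁ cl⊆H = ⊥-elim (x∉H (cl⊆H (⊆cl (∈-∪⁺ʳ (SP.x∈⁅x⁆ x)))))
    ... | inj₂ E⊆cl = begin
      r M (E M)          ≤⟨ r-mono M _ _ E⊆cl (proj₁ cl-flat) ⟩
      r M cl             ≡⟨ r-cl ⟩
      r M (H ∪ ⁅ x ⁆)    ≤⟨ r-insert (proj₁ flH) x∈E ⟩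
      suc (r M H)        ∎

record IsSimpleLine (M : Matroid m) (X : Subset m) : Set where
  field
    ⊆E     : X ⊆ E M
    r≡2    : r M X ≡ 2
    r-pair : ∀ {x y} → x ∈ X → y ∈ X → x ≢ y → 2 ≤ r M (⁅ x ⁆ ∪ ⁅ y ⁆)

uniform⇒isSimpleLine : ∀ {M : Matroid m} {X} → 2 ≤ n → RestrictionIsoUniform M X 2 n → IsSimpleLine M X
uniform⇒isSimpleLine {m} {n} {M} {X} 2≤n (X⊆E , f , _ , f[⊤]≡X , r-image) = record
  { ⊆E = X⊆E ; r≡2 = r≡2 ; r-pair = r-pair }
  where
  r-image≡2 : ∀ A → 2 ≤ ∣ A ∣ → r M (image f A) ≡ 2
  r-image≡2 A 2≤∣A∣ = trans (r-image A) (ℕ.m≥n⇒m⊓n≡n 2≤∣A∣)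
  r≡2 : r M X ≡ 2
  r≡2 = trans (cong (r M) (sym f[⊤]≡X)) (r-image≡2 ⊤ (subst (2 ≤_) (sym (SP.∣⊤∣≡n n)) 2≤n))
  preimage : x ∈ X → ∃ λ i → f i ≡ x
  preimage x∈X with ∈-image⁻ f (subst (_ ∈_) (sym f[⊤]≡X) x∈X)
  ... | i , _ , fi≡x = i , fi≡x
  r-pair : ∀ {x y} → x ∈ X → y ∈ X → x ≢ y → 2 ≤ r M (⁅ x ⁆ ∪ ⁅ y ⁆)
  r-pair x∈X y∈X x≢y with preimage x∈X | preimage y∈X
  ... | i , refl | j , refl = ℕ.≤-trans (ℕ.≤-reflexive (sym (r-image≡2 (⁅ i ⁆ ∪ ⁅ j ⁆) 2≤∣ij∣)))
          (r-mono M _ _ (image-⊆ f f-pair) (∪-least (⁅⁆-⊆ (X⊆E x∈X)) (⁅⁆-⊆ (X⊆E y∈X))))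
    where
    2≤∣ij∣ : 2 ≤ ∣ ⁅ i ⁆ ∪ ⁅ j ⁆ ∣
    2≤∣ij∣ = subst (λ k → suc k ≤ ∣ ⁅ i ⁆ ∪ ⁅ j ⁆ ∣) (SP.∣⁅x⁆∣≡1 i) (SP.p⊂q⇒∣p∣<∣q∣
      (∈-∪⁺ˡ , j , ∈-∪⁺ʳ (SP.x∈⁅x⁆ j) , λ j∈⁅i⁆ → x≢y (cong f (sym (SP.x∈⁅y⁆⇒x≡y i j∈⁅i⁆)))))
    f-pair : ∀ {k} → k ∈ ⁅ i ⁆ ∪ ⁅ j ⁆ → f k ∈ ⁅ f i ⁆ ∪ ⁅ f j ⁆
    f-pair k∈ with ∈-∪⁻ k∈
    ... | inj₁ k∈⁅i⁆ = ∈-∪⁺ˡ (subst (λ t → f t ∈ ⁅ f i ⁆) (sym (SP.x∈⁅y⁆⇒x≡y i k∈⁅i⁆)) (SP.x∈⁅x⁆ (f i)))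
    ... | inj₂ k∈⁅j⁆ = ∈-∪⁺ʳ (subst (λ t → f t ∈ ⁅ f j ⁆) (sym (SP.x∈⁅y⁆⇒x≡y j k∈⁅j⁆)) (SP.x∈⁅x⁆ (f j)))

isSimpleLine-restrict : ∀ {M₁ M₂ : Matroid m} {X}
  → SameRestriction M₁ M₂ X → IsSimpleLine M₂ X → IsSimpleLine M₁ X
isSimpleLine-restrict (X⊆E₁ , _ , r₁≡r₂) line = record
  { ⊆E = X⊆E₁
  ; r≡2 = trans (r₁≡r₂ _ id) r≡2
  ; r-pair = λ x∈X y∈X x≢y →
      subst (2 ≤_) (sym (r₁≡r₂ _ (∪-least (⁅⁆-⊆ x∈X) (⁅⁆-⊆ y∈X)))) (r-pair x∈X y∈X x≢y) }
  where open IsSimpleLine line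

module SimpleLine {m} {M : Matroid m} {X : Subset m} (line : IsSimpleLine M X) where
  open IsSimpleLine line
  open MatroidProperties M

  point : Nonempty X
  point with nonempty? X
  ... | yes x∈X = x∈X
  ... | no X-empty with trans (sym r≡2) (trans (cong (r M) (SP.Empty-unique X-empty)) r-∅)
  ...   | ()

  2≤∣X∣ : 2 ≤ ∣ X ∣
  2≤∣X∣ = subst (_≤ ∣ X ∣) r≡2 (r-bound M X ⊆E)

  flat-⊇-pair : Flat M p → x ∈ p → y ∈ p → x ∈ X → y ∈ X → x ≢ y → X ⊆ p
  flat-⊇-pair {p = G} {x} {y} flG x∈G y∈G x∈X y∈X x≢y = flat-absorbs-∩ flG ⊆E (begin
    r M X                   ≡⟨ r≡2 ⟩
    2                       ≤⟨ r-pair x∈X y∈X x≢y ⟩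
    r M (⁅ x ⁆ ∪ ⁅ y ⁆)     ≤⟨ r-mono M _ _ xy⊆G∩X (λ z∈ → proj₁ flG (∈-∩⁻ˡ z∈)) ⟩
    r M (G ∩ X)             ∎)
    where
    open ℕ.≤-Reasoning
    xy⊆G∩X : ⁅ x ⁆ ∪ ⁅ y ⁆ ⊆ G ∩ X
    xy⊆G∩X = ∪-least (⁅⁆-⊆ (∈-∩⁺ x∈G x∈X)) (⁅⁆-⊆ (∈-∩⁺ y∈G y∈X))

  flat-∩-line-unique : Flat M p → x ∈ p → x ∈ X → y ∈ X → y ∉ p → z ∈ p → z ∈ X → z ≡ x
  flat-∩-line-unique {x = x} {z = z} flG x∈G x∈X y∈X y∉G z∈G z∈X = decidable-stable (z ≟ x)
    λ z≢x → y∉G (flat-⊇-pair flG z∈G x∈G z∈X x∈X z≢x y∈X)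

module ModularLine {m} {M : Matroid m} {X : Subset m}
  (line : IsSimpleLine M X) (mod : ModularFlat M X) where
  open IsSimpleLine line
  open MatroidProperties M
  open SimpleLine line

  r-∪-disjoint : Flat M p → Empty (X ∩ p) → r M (X ∪ p) ≡ 2 + r M p
  r-∪-disjoint {p = G} flG empty = trans (r-∪-modular-disjoint mod flG empty) (cong (_+ r M G) r≡2)

  -- A point of X added to a flat disjoint from X raises the rank by at most 1, too little to span X.
  closure-insert-∩-line : Flat M p → Empty (X ∩ p) → x ∈ X → (c : Closure M (p ∪ ⁅ x ⁆))
    → z ∈ Closure.cl c → z ∈ X → z ≡ x
  closure-insert-∩-line {p = G} {x} {z} flG empty x∈X c z∈cl z∈X = decidable-stable (z ≟ x)
    λ z≢x → ℕ.<-irrefl refl (too-big z≢x)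
    where
    open Closure c
    open ℕ.≤-Reasoning
    x∈cl : x ∈ cl
    x∈cl = ⊆cl (∈-∪⁺ʳ (SP.x∈⁅x⁆ x))
    too-big : z ≢ x → 2 + r M G ≤ suc (r M G)
    too-big z≢x = begin
      2 + r M G          ≡⟨ sym (r-∪-disjoint flG empty) ⟩
      r M (X ∪ G)        ≤⟨ r-mono M _ _ X∪G⊆cl (proj₁ cl-flat) ⟩
      r M cl             ≡⟨ r-cl ⟩
      r M (G ∪ ⁅ x ⁆)    ≤⟨ r-insert (proj₁ flG) (⊆E x∈X) ⟩
      suc (r M G)        ∎
      where
      X∪G⊆cl : X ∪ G ⊆ cl
      X∪G⊆cl = ∪-least (flat-⊇-pair cl-flat z∈cl x∈cl z∈X x∈X z≢x) (λ g → ⊆cl (∈-∪⁺ˡ g))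

isGenParallelConnection-comm : ∀ {M₁ M₂ P : Matroid m} {X}
  → IsGenParallelConnection M₁ M₂ X P → IsGenParallelConnection M₂ M₁ X P
isGenParallelConnection-comm {M₁ = M₁} {M₂} (E-P , flats) =
  trans E-P (SP.∪-comm (E M₁) (E M₂)) ,
  λ F → mk⇔ (swap ∘ Equivalence.to (flats F)) (Equivalence.from (flats F) ∘ swap)
  where
  swap : ∀ {F A B : Subset m} {S T : Set} → F ⊆ A ∪ B × S × T → F ⊆ B ∪ A × T × S
  swap {A = A} {B} (F⊆A∪B , s , t) = (λ x∈F → subst (_ ∈_) (SP.∪-comm A B) (F⊆A∪B x∈F)) , t , s

module GenParallelConnection {m} {Ma Mb P : Matroid m} {X : Subset m}
  (Ea∩Eb≡X : E Ma ∩ E Mb ≡ X) (pc : IsGenParallelConnection Ma Mb X P) where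

  open IsMaximalFlat
  private
    module Ma = MatroidProperties Ma
    module Mb = MatroidProperties Mb

  X⊆Eₐ : X ⊆ E Ma
  X⊆Eₐ x∈X = ∈-∩⁻ˡ (subst (_ ∈_) (sym Ea∩Eb≡X) x∈X)

  X⊆Eᵦ : X ⊆ E Mb
  X⊆Eᵦ x∈X = ∈-∩⁻ʳ (subst (_ ∈_) (sym Ea∩Eb≡X) x∈X)

  ∈-X : x ∈ E Ma → x ∈ E Mb → x ∈ X
  ∈-X x∈a x∈b = subst (_ ∈_) Ea∩Eb≡X (∈-∩⁺ x∈a x∈b)

  ∈-E⁻ : x ∈ E P → x ∈ E Ma ⊎ x ∈ E Mb
  ∈-E⁻ x∈ = ∈-∪⁻ (subst (_ ∈_) (proj₁ pc) x∈)

  ⊆-E : p ⊆ E Ma ∪ E Mb → p ⊆ E P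
  ⊆-E p⊆ x∈ = subst (_ ∈_) (sym (proj₁ pc)) (p⊆ x∈)

  E-⊆ : E Ma ⊆ p → E Mb ⊆ p → E P ⊆ p
  E-⊆ a⊆p b⊆p x∈ = [ a⊆p , b⊆p ]′ (∈-E⁻ x∈)

  ⊆-by-parts : p ⊆ E P → p ∩ E Ma ⊆ q → p ∩ E Mb ⊆ q → p ⊆ q
  ⊆-by-parts p⊆E a⊆q b⊆q x∈p =
    [ (λ x∈a → a⊆q (∈-∩⁺ x∈p x∈a)) , (λ x∈b → b⊆q (∈-∩⁺ x∈p x∈b)) ]′ (∈-E⁻ (p⊆E x∈p))

  flat-from-parts : p ⊆ E P → Flat Ma (p ∩ E Ma) → Flat Mb (p ∩ E Mb) → Flat P p
  flat-from-parts p⊆E flₐ flᵦ =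
    Equivalence.from (proj₂ pc _) ((λ x∈ → subst (_ ∈_) (proj₁ pc) (p⊆E x∈)) , flₐ , flᵦ)

  flat-∩ₐ : Flat P p → Flat Ma (p ∩ E Ma)
  flat-∩ₐ flp = proj₁ (proj₂ (Equivalence.to (proj₂ pc _) flp))

  flat-∩ᵦ : Flat P p → Flat Mb (p ∩ E Mb)
  flat-∩ᵦ flp = proj₂ (proj₂ (Equivalence.to (proj₂ pc _) flp))

  AgreeOnX : Subset m → Subset m → Set
  AgreeOnX G C = (∀ {x} → x ∈ X → x ∈ G → x ∈ C) × (∀ {x} → x ∈ X → x ∈ C → x ∈ G)

  flat-glue : Flat Ma G → Flat Mb C → AgreeOnX G C → Flat P (G ∪ C)
  flat-glue {G = G} {C} flG flC (G⇒C , C⇒G) = flat-from-parts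
    (⊆-E (∪-least (∈-∪⁺ˡ ∘ proj₁ flG) (∈-∪⁺ʳ ∘ proj₁ flC)))
    (subst (Flat Ma) (sym (∪-∩-absorbʳ (proj₁ flG) C∩Ea⊆G)) flG)
    (subst (Flat Mb) (sym (trans (cong (_∩ E Mb) (SP.∪-comm G C)) (∪-∩-absorbʳ (proj₁ flC) G∩Eb⊆C))) flC)
    where
    C∩Ea⊆G : ∀ {x} → x ∈ C → x ∈ E Ma → x ∈ G
    C∩Ea⊆G x∈C x∈a = C⇒G (∈-X x∈a (proj₁ flC x∈C)) x∈C
    G∩Eb⊆C : ∀ {x} → x ∈ G → x ∈ E Mb → x ∈ C
    G∩Eb⊆C x∈G x∈b = G⇒C (∈-X (proj₁ flG x∈G) x∈b) x∈G

  maximal-glue : IsMaximalFlat P H → Flat Ma G → Flat Mb C → AgreeOnX G C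
    → H ∩ E Ma ⊆ G → H ∩ E Mb ⊆ C → (G ⊆ H × C ⊆ H) ⊎ (E Ma ⊆ G × E Mb ⊆ C)
  maximal-glue {H = H} {G} {C} maxH flG flC agree@(G⇒C , C⇒G) Ha⊆G Hb⊆C =
    conclude (maximal maxH (G ∪ C) (flat-glue flG flC agree) H⊆G∪C)
    where
    H⊆G∪C : H ⊆ G ∪ C
    H⊆G∪C = ⊆-by-parts (proj₁ (isFlat maxH)) (∈-∪⁺ˡ ∘ Ha⊆G) (∈-∪⁺ʳ ∘ Hb⊆C)
    conclude : G ∪ C ⊆ H ⊎ E P ⊆ G ∪ C → (G ⊆ H × C ⊆ H) ⊎ (E Ma ⊆ G × E Mb ⊆ C)
    conclude (inj₁ G∪C⊆H) = inj₁ ((λ x∈G → G∪C⊆H (∈-∪⁺ˡ x∈G)) , (λ x∈C → G∪C⊆H (∈-∪⁺ʳ x∈C)))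
    conclude (inj₂ E⊆G∪C) = inj₂ (Eₐ⊆G , Eᵦ⊆C)
      where
      Eₐ⊆G : E Ma ⊆ G
      Eₐ⊆G x∈a = [ id , (λ x∈C → C⇒G (∈-X x∈a (proj₁ flC x∈C)) x∈C) ]′
        (∈-∪⁻ (E⊆G∪C (⊆-E ∈-∪⁺ˡ x∈a)))
      Eᵦ⊆C : E Mb ⊆ C
      Eᵦ⊆C x∈b = [ (λ x∈G → G⇒C (∈-X (proj₁ flG x∈G) x∈b) x∈G) , id ]′
        (∈-∪⁻ (E⊆G∪C (⊆-E ∈-∪⁺ʳ x∈b)))

  maximal-extendₐ : IsMaximalFlat P H → Flat Ma G → Flat Mb C → AgreeOnX G C
    → H ∩ E Ma ⊆ G → H ∩ E Mb ⊆ C → G ⊆ H ∩ E Ma ⊎ E Ma ⊆ G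
  maximal-extendₐ maxH flG flC agree Ha⊆G Hb⊆C = Sum.map (λ (G⊆H , _) → ⊆-∩⁺ G⊆H (proj₁ flG)) proj₁
    (maximal-glue maxH flG flC agree Ha⊆G Hb⊆C)

  maximal-⊇Eₐ⇒maximal-∩ᵦ : IsMaximalFlat P H → E Ma ⊆ H → IsMaximalFlat Mb (H ∩ E Mb)
  maximal-⊇Eₐ⇒maximal-∩ᵦ {H = H} maxH Ea⊆H = record
    { isFlat = flat-∩ᵦ (isFlat maxH) ; proper = outside (proper maxH) ; maximal = maximalᵦ }
    where
    outside : (∃ λ x → x ∈ E P × x ∉ H) → ∃ λ x → x ∈ E Mb × x ∉ H ∩ E Mb
    outside (x , x∈E , x∉H) =
      [ (λ x∈a → ⊥-elim (x∉H (Ea⊆H x∈a))) , (λ x∈b → x , x∈b , x∉H ∘ ∈-∩⁻ˡ) ]′ (∈-E⁻ x∈E)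
    agree : H ∩ E Mb ⊆ G → AgreeOnX (E Ma) G
    agree Hb⊆G = (λ x∈X _ → Hb⊆G (∈-∩⁺ (Ea⊆H (X⊆Eₐ x∈X)) (X⊆Eᵦ x∈X))) , (λ x∈X _ → X⊆Eₐ x∈X)
    maximalᵦ : ∀ G → Flat Mb G → H ∩ E Mb ⊆ G → G ⊆ H ∩ E Mb ⊎ E Mb ⊆ G
    maximalᵦ G flG Hb⊆G = Sum.map (λ (_ , G⊆H) → ⊆-∩⁺ G⊆H (proj₁ flG)) proj₂
      (maximal-glue maxH Ma.E-flat flG (agree Hb⊆G) ∈-∩⁻ʳ Hb⊆G)

  maximal-⊇X⇒⊇Eₐ⊎⊇Eᵦ : IsMaximalFlat P H → X ⊆ H → E Ma ⊆ H ⊎ E Mb ⊆ H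
  maximal-⊇X⇒⊇Eₐ⊎⊇Eᵦ {H = H} maxH X⊆H =
    conclude (maximal-glue maxH (flat-∩ₐ (isFlat maxH)) Mb.E-flat agree id ∈-∩⁻ʳ)
    where
    agree : AgreeOnX (H ∩ E Ma) (E Mb)
    agree = (λ x∈X _ → X⊆Eᵦ x∈X) , (λ x∈X _ → ∈-∩⁺ (X⊆H x∈X) (X⊆Eₐ x∈X))
    conclude : (H ∩ E Ma ⊆ H × E Mb ⊆ H) ⊎ (E Ma ⊆ H ∩ E Ma × E Mb ⊆ E Mb) → E Ma ⊆ H ⊎ E Mb ⊆ H
    conclude (inj₁ (_ , Eb⊆H)) = inj₂ Eb⊆H
    conclude (inj₂ (Ea⊆Ha , _)) = inj₁ (∈-∩⁻ˡ ∘ Ea⊆Ha)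

  maximal-∩ᵦ-⊇Eₐ⇒maximal : H ⊆ E P → E Ma ⊆ H → IsMaximalFlat Mb (H ∩ E Mb) → IsMaximalFlat P H
  maximal-∩ᵦ-⊇Eₐ⇒maximal {H = H} H⊆E Ea⊆H maxHb = record
    { isFlat = flat-from-parts H⊆E (subst (Flat Ma) (sym Ha≡Ea) Ma.E-flat) (isFlat maxHb)
    ; proper = let x , x∈b , x∉Hb = proper maxHb in x , ⊆-E ∈-∪⁺ʳ x∈b , λ x∈H → x∉Hb (∈-∩⁺ x∈H x∈b)
    ; maximal = maximalP }
    where
    Ha≡Ea : H ∩ E Ma ≡ E Ma
    Ha≡Ea = SP.⊆-antisym ∈-∩⁻ʳ (⊆-∩⁺ Ea⊆H id)
    maximalP : ∀ F → Flat P F → H ⊆ F → F ⊆ H ⊎ E P ⊆ F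
    maximalP F flF H⊆F = conclude (maximal maxHb (F ∩ E Mb) (flat-∩ᵦ flF) (∩-monoˡ H⊆F))
      where
      conclude : F ∩ E Mb ⊆ H ∩ E Mb ⊎ E Mb ⊆ F ∩ E Mb → F ⊆ H ⊎ E P ⊆ F
      conclude (inj₁ Fb⊆Hb) = inj₁ (⊆-by-parts (proj₁ flF) (Ea⊆H ∘ ∈-∩⁻ʳ) (∈-∩⁻ˡ ∘ Fb⊆Hb))
      conclude (inj₂ Eb⊆Fb) = inj₂ (E-⊆ (H⊆F ∘ Ea⊆H) (∈-∩⁻ˡ ∘ Eb⊆Fb))

  maximal-parts⇒maximal : H ⊆ E P → IsMaximalFlat Ma (H ∩ E Ma) → IsMaximalFlat Mb (H ∩ E Mb) → ¬ X ⊆ H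
    → IsMaximalFlat P H
  maximal-parts⇒maximal {H = H} H⊆E maxHa maxHb X⊈H = record
    { isFlat = flat-from-parts H⊆E (isFlat maxHa) (isFlat maxHb)
    ; proper = let x , x∈a , x∉Ha = proper maxHa in x , ⊆-E ∈-∪⁺ˡ x∈a , λ x∈H → x∉Ha (∈-∩⁺ x∈H x∈a)
    ; maximal = λ F flF H⊆F → combine F flF (maximal maxHa (F ∩ E Ma) (flat-∩ₐ flF) (∩-monoˡ H⊆F))
                                           (maximal maxHb (F ∩ E Mb) (flat-∩ᵦ flF) (∩-monoˡ H⊆F)) }
    where
    -- In the mixed cases the full side puts X into F, and the other side then puts it into H.
    combine : ∀ F → Flat P F
      → F ∩ E Ma ⊆ H ∩ E Ma ⊎ E Ma ⊆ F ∩ E Ma → F ∩ E Mb ⊆ H ∩ E Mb ⊎ E Mb ⊆ F ∩ E Mb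
      → F ⊆ H ⊎ E P ⊆ F
    combine F flF (inj₁ Fa⊆Ha) (inj₁ Fb⊆Hb) =
      inj₁ (⊆-by-parts (proj₁ flF) (∈-∩⁻ˡ ∘ Fa⊆Ha) (∈-∩⁻ˡ ∘ Fb⊆Hb))
    combine F flF (inj₂ Ea⊆Fa) (inj₂ Eb⊆Fb) = inj₂ (E-⊆ (∈-∩⁻ˡ ∘ Ea⊆Fa) (∈-∩⁻ˡ ∘ Eb⊆Fb))
    combine F flF (inj₁ Fa⊆Ha) (inj₂ Eb⊆Fb) =
      ⊥-elim (X⊈H λ x∈X → ∈-∩⁻ˡ (Fa⊆Ha (∈-∩⁺ (∈-∩⁻ˡ (Eb⊆Fb (X⊆Eᵦ x∈X))) (X⊆Eₐ x∈X))))
    combine F flF (inj₂ Ea⊆Fa) (inj₁ Fb⊆Hb) =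
      ⊥-elim (X⊈H λ x∈X → ∈-∩⁻ˡ (Fb⊆Hb (∈-∩⁺ (∈-∩⁻ˡ (Ea⊆Fa (X⊆Eₐ x∈X))) (X⊆Eᵦ x∈X))))

  splitting-X⇒∣∩X∣≡1 : IsSimpleLine Ma X → Flat Ma (H ∩ E Ma)
    → x ∈ H → x ∈ X → y ∈ X → y ∉ H → ∣ H ∩ X ∣ ≡ 1
  splitting-X⇒∣∩X∣≡1 lineₐ flHa x∈H x∈X y∈X y∉H = ∣p∣≡1 (∈-∩⁺ x∈H x∈X) λ z∈ →
    flat-∩-line-unique flHa (∈-∩⁺ x∈H (X⊆Eₐ x∈X)) x∈X y∈X (y∉H ∘ ∈-∩⁻ˡ)
      (∈-∩⁺ (∈-∩⁻ˡ z∈) (X⊆Eₐ (∈-∩⁻ʳ z∈))) (∈-∩⁻ʳ z∈)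
    where open SimpleLine lineₐ

  maximal-splitting-X⇒maximal-∩ₐ : IsSimpleLine Ma X → IsMaximalFlat P H → x ∈ H → x ∈ X → y ∈ X → y ∉ H
    → IsMaximalFlat Ma (H ∩ E Ma)
  maximal-splitting-X⇒maximal-∩ₐ {H = H} {x} {y} lineₐ maxH x∈H x∈X y∈X y∉H = record
    { isFlat = flHa ; proper = y , X⊆Eₐ y∈X , y∉H ∘ ∈-∩⁻ˡ ; maximal = maximalₐ }
    where
    open SimpleLine lineₐ
    flHa = flat-∩ₐ (isFlat maxH)
    flHb = flat-∩ᵦ (isFlat maxH)
    maximalₐ : ∀ G → Flat Ma G → H ∩ E Ma ⊆ G → G ⊆ H ∩ E Ma ⊎ E Ma ⊆ G
    maximalₐ G flG Ha⊆G with y ∈? G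
    ... | yes y∈G = maximal-extendₐ maxH flG Mb.E-flat ((λ z∈X _ → X⊆Eᵦ z∈X) , (λ z∈X _ → X⊆G z∈X))
                      Ha⊆G ∈-∩⁻ʳ
      where
      x∈G = Ha⊆G (∈-∩⁺ x∈H (X⊆Eₐ x∈X))
      X⊆G : X ⊆ G
      X⊆G = flat-⊇-pair flG x∈G y∈G x∈X y∈X λ x≡y → y∉H (subst (_∈ H) x≡y x∈H)
    ... | no y∉G = maximal-extendₐ maxH flG flHb (G⇒Hb , Hb⇒G) Ha⊆G id
      where
      G⇒Hb : ∀ {z} → z ∈ X → z ∈ G → z ∈ H ∩ E Mb
      G⇒Hb z∈X z∈G = subst (_∈ H ∩ E Mb)
        (sym (flat-∩-line-unique flG (Ha⊆G (∈-∩⁺ x∈H (X⊆Eₐ x∈X))) x∈X y∈X y∉G z∈G z∈X))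
        (∈-∩⁺ x∈H (X⊆Eᵦ x∈X))
      Hb⇒G : ∀ {z} → z ∈ X → z ∈ H ∩ E Mb → z ∈ G
      Hb⇒G z∈X z∈Hb = Ha⊆G (∈-∩⁺ (∈-∩⁻ˡ z∈Hb) (X⊆Eₐ z∈X))

  module _ (lineᵦ : IsSimpleLine Mb X) (modᵦ : ModularFlat Mb X) where
    open SimpleLine lineᵦ using (point)
    open ModularLine lineᵦ modᵦ

    private
      X∩Hb-empty : Empty (H ∩ X) → Empty (X ∩ (H ∩ E Mb))
      X∩Hb-empty = Empty-⊆ λ x∈ → ∈-∩⁺ (∈-∩⁻ˡ (∈-∩⁻ʳ x∈)) (∈-∩⁻ˡ x∈)

      r-X∪Hb≡r-E : Flat Mb (H ∩ E Mb) → Empty (H ∩ X) → r Mb (H ∩ E Mb) + 2 ≡ r Mb (E Mb)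
        → r Mb (X ∪ (H ∩ E Mb)) ≡ r Mb (E Mb)
      r-X∪Hb≡r-E {H = H} flHb H∩X-empty rHb+2≡rE =
        trans (r-∪-disjoint flHb (X∩Hb-empty H∩X-empty)) (trans (ℕ.+-comm 2 (r Mb (H ∩ E Mb))) rHb+2≡rE)

    maximal-disjoint-X⇒corank2-∩ᵦ : IsMaximalFlat P H → Empty (H ∩ X) → Corank2Flat Mb (H ∩ E Mb)
    maximal-disjoint-X⇒corank2-∩ᵦ {H = H} maxH H∩X-empty = flHb , (begin
      r Mb (H ∩ E Mb) + 2         ≡⟨ ℕ.+-comm (r Mb (H ∩ E Mb)) 2 ⟩
      2 + r Mb (H ∩ E Mb)         ≡⟨ sym (r-∪-disjoint flHb (X∩Hb-empty H∩X-empty)) ⟩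
      r Mb (X ∪ (H ∩ E Mb))       ≡⟨ ℕ.≤-antisym (r-mono Mb _ _ X∪Hb⊆E id) r-E≤ ⟩
      r Mb (E Mb)                 ∎)
      where
      open Relation.Binary.PropositionalEquality.≡-Reasoning
      flHb = flat-∩ᵦ (isFlat maxH)
      X∪Hb⊆E = ∪-least X⊆Eᵦ (proj₁ flHb)
      open Closure (Mb.closure X∪Hb⊆E)
      agree : AgreeOnX (E Ma) cl
      agree = (λ x∈X _ → ⊆cl (∈-∪⁺ˡ x∈X)) , (λ x∈X _ → X⊆Eₐ x∈X)
      E⊆cl : E Mb ⊆ cl
      E⊆cl with maximal-glue maxH Ma.E-flat cl-flat agree ∈-∩⁻ʳ (⊆cl ∘ ∈-∪⁺ʳ)
      ... | inj₁ (Ea⊆H , _) = let x , x∈X = point in ⊥-elim (H∩X-empty (x , ∈-∩⁺ (Ea⊆H (X⊆Eₐ x∈X)) x∈X))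
      ... | inj₂ (_ , Eb⊆cl) = Eb⊆cl
      r-E≤ : r Mb (E Mb) ≤ r Mb (X ∪ (H ∩ E Mb))
      r-E≤ = subst (r Mb (E Mb) ≤_) r-cl (r-mono Mb _ _ E⊆cl (proj₁ cl-flat))

    maximal-disjoint-X⇒maximal-∩ₐ : IsSimpleLine Ma X → IsMaximalFlat P H → Empty (H ∩ X)
      → IsMaximalFlat Ma (H ∩ E Ma)
    maximal-disjoint-X⇒maximal-∩ₐ {H = H} lineₐ maxH H∩X-empty = record
      { isFlat = flat-∩ₐ (isFlat maxH)
      ; proper = let x , x∈X = point in x , X⊆Eₐ x∈X , λ x∈Ha → H∩X-empty (x , ∈-∩⁺ (∈-∩⁻ˡ x∈Ha) x∈X)
      ; maximal = maximalₐ }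
      where
      open SimpleLine lineₐ using (flat-∩-line-unique)
      flHb = flat-∩ᵦ (isFlat maxH)
      maximalₐ : ∀ G → Flat Ma G → H ∩ E Ma ⊆ G → G ⊆ H ∩ E Ma ⊎ E Ma ⊆ G
      maximalₐ G flG Ha⊆G with X ⊆? G | nonempty? (G ∩ X)
      ... | yes X⊆G | _ =
        maximal-extendₐ maxH flG Mb.E-flat ((λ z∈X _ → X⊆Eᵦ z∈X) , (λ z∈X _ → X⊆G z∈X)) Ha⊆G ∈-∩⁻ʳ
      ... | no _ | no G∩X-empty = maximal-extendₐ maxH flG flHb
        ( (λ z∈X z∈G → ⊥-elim (G∩X-empty (_ , ∈-∩⁺ z∈G z∈X)))
        , (λ z∈X z∈Hb → ⊥-elim (H∩X-empty (_ , ∈-∩⁺ (∈-∩⁻ˡ z∈Hb) z∈X))) ) Ha⊆G id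
      ... | no X⊈G | yes (x , x∈G∩X) =
        maximal-extendₐ maxH flG cl-flat (G⇒cl , cl⇒G) Ha⊆G (⊆cl ∘ ∈-∪⁺ˡ)
        where
        x∈G = ∈-∩⁻ˡ x∈G∩X
        x∈X = ∈-∩⁻ʳ x∈G∩X
        Hb+x = Mb.closure (∪-least (proj₁ flHb) (⁅⁆-⊆ (X⊆Eᵦ x∈X)))
        open Closure Hb+x
        x∈cl : x ∈ cl
        x∈cl = ⊆cl (∈-∪⁺ʳ (SP.x∈⁅x⁆ x))
        G⇒cl : ∀ {z} → z ∈ X → z ∈ G → z ∈ cl
        G⇒cl z∈X z∈G = let w , w∈X , w∉G = ⊈⇒∃∉ X⊈G in
          subst (_∈ cl) (sym (flat-∩-line-unique flG x∈G x∈X w∈X w∉G z∈G z∈X)) x∈cl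
        cl⇒G : ∀ {z} → z ∈ X → z ∈ cl → z ∈ G
        cl⇒G z∈X z∈cl = subst (_∈ G)
          (sym (closure-insert-∩-line flHb (X∩Hb-empty H∩X-empty) x∈X Hb+x z∈cl z∈X)) x∈G

    disjoint-X-parts⇒maximal : H ⊆ E P → IsMaximalFlat Ma (H ∩ E Ma) → Corank2Flat Mb (H ∩ E Mb)
      → Empty (H ∩ X) → IsMaximalFlat P H
    disjoint-X-parts⇒maximal {H = H} H⊆E maxHa (flHb , rHb+2≡rE) H∩X-empty = record
      { isFlat = flat-from-parts H⊆E (isFlat maxHa) flHb
      ; proper = let x , x∈X = point in x , ⊆-E (∈-∪⁺ˡ ∘ X⊆Eₐ) x∈X , λ x∈H → H∩X-empty (x , ∈-∩⁺ x∈H x∈X)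
      ; maximal = maximalP }
      where
      open ℕ.≤-Reasoning
      maximalP : ∀ F → Flat P F → H ⊆ F → F ⊆ H ⊎ E P ⊆ F
      maximalP F flF H⊆F = conclude (maximal maxHa (F ∩ E Ma) (flat-∩ₐ flF) (∩-monoˡ H⊆F))
        where
        flFb = flat-∩ᵦ flF
        Hb⊆Fb : H ∩ E Mb ⊆ F ∩ E Mb
        Hb⊆Fb = ∩-monoˡ H⊆F
        conclude : F ∩ E Ma ⊆ H ∩ E Ma ⊎ E Ma ⊆ F ∩ E Ma → F ⊆ H ⊎ E P ⊆ F
        conclude (inj₁ Fa⊆Ha) = inj₁ (⊆-by-parts (proj₁ flF) (∈-∩⁻ˡ ∘ Fa⊆Ha) (∈-∩⁻ˡ ∘ Fb⊆Hb))
          where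
          X∩Fb-empty : Empty (X ∩ (F ∩ E Mb))
          X∩Fb-empty = Empty-⊆ (λ x∈ → ∈-∩⁺ (∈-∩⁻ˡ (Fa⊆Ha (∈-∩⁺ (∈-∩⁻ˡ (∈-∩⁻ʳ x∈)) (X⊆Eₐ (∈-∩⁻ˡ x∈)))))
                                          (∈-∩⁻ˡ x∈)) H∩X-empty
          Fb⊆Hb : F ∩ E Mb ⊆ H ∩ E Mb
          Fb⊆Hb = Mb.flat-absorbs flHb Hb⊆Fb (proj₁ flFb) (ℕ.+-cancelˡ-≤ 2 _ _ (begin
            2 + r Mb (F ∩ E Mb)       ≡⟨ sym (r-∪-disjoint flFb X∩Fb-empty) ⟩
            r Mb (X ∪ (F ∩ E Mb))     ≤⟨ r-mono Mb _ _ (∪-least X⊆Eᵦ (proj₁ flFb)) id ⟩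
            r Mb (E Mb)               ≡⟨ sym (r-X∪Hb≡r-E flHb H∩X-empty rHb+2≡rE) ⟩
            r Mb (X ∪ (H ∩ E Mb))     ≡⟨ r-∪-disjoint flHb (X∩Hb-empty H∩X-empty) ⟩
            2 + r Mb (H ∩ E Mb)       ∎))
        conclude (inj₂ Ea⊆Fa) = inj₂ (E-⊆ (∈-∩⁻ˡ ∘ Ea⊆Fa) (∈-∩⁻ˡ ∘ Eb⊆Fb))
          where
          X⊆Fb : X ⊆ F ∩ E Mb
          X⊆Fb x∈X = ∈-∩⁺ (∈-∩⁻ˡ (Ea⊆Fa (X⊆Eₐ x∈X))) (X⊆Eᵦ x∈X)
          Eb⊆Fb : E Mb ⊆ F ∩ E Mb
          Eb⊆Fb = Mb.flat-absorbs flFb (proj₁ flFb) id (begin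
            r Mb (E Mb)               ≡⟨ sym (r-X∪Hb≡r-E flHb H∩X-empty rHb+2≡rE) ⟩
            r Mb (X ∪ (H ∩ E Mb))     ≤⟨ r-mono Mb _ _ (∪-least X⊆Fb Hb⊆Fb) (proj₁ flFb) ⟩
            r Mb (F ∩ E Mb)           ∎)

HyperplaneCases : Matroid m → Matroid m → Subset m → Subset m → Set
HyperplaneCases M₁ M₂ X H =
  (E M₁ ⊆ H × Hyperplane M₂ (H ∩ E M₂) × X ⊆ H ∩ E M₂)
  ⊎ (E M₂ ⊆ H × Hyperplane M₁ (H ∩ E M₁) × X ⊆ H ∩ E M₁)
  ⊎ (Hyperplane M₁ (H ∩ E M₁) × Hyperplane M₂ (H ∩ E M₂) × ∣ H ∩ X ∣ ≡ 1)
  ⊎ (Hyperplane M₁ (H ∩ E M₁) × Empty (H ∩ E M₁ ∩ X)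
     × Corank2Flat M₂ (H ∩ E M₂) × Empty (H ∩ E M₂ ∩ X))

module Hyperplanes {m} {M₁ M₂ P : Matroid m} {X : Subset m}
  (E₁∩E₂≡X : E M₁ ∩ E M₂ ≡ X) (pc : IsGenParallelConnection M₁ M₂ X P)
  (line₁ : IsSimpleLine M₁ X) (line₂ : IsSimpleLine M₂ X) (mod₂ : ModularFlat M₂ X) where

  open IsMaximalFlat
  private
    module M₁ = MatroidProperties M₁
    module M₂ = MatroidProperties M₂
    module P = MatroidProperties P
    module C₁₂ = GenParallelConnection {Ma = M₁} {M₂} {P} E₁∩E₂≡X pc
    module C₂₁ = GenParallelConnection {Ma = M₂} {M₁} {P} (trans (SP.∩-comm (E M₂) (E M₁)) E₁∩E₂≡X)
                                       (isGenParallelConnection-comm {M₁ = M₁} {M₂} {P} {X} pc)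

    maximal⇒cases : IsMaximalFlat P H → HyperplaneCases M₁ M₂ X H
    maximal⇒cases {H = H} maxH with X ⊆? H
    ... | yes X⊆H with C₁₂.maximal-⊇X⇒⊇Eₐ⊎⊇Eᵦ maxH X⊆H
    ...   | inj₁ E₁⊆H = inj₁
      (E₁⊆H , M₂.maximal⇒hyperplane (C₁₂.maximal-⊇Eₐ⇒maximal-∩ᵦ maxH E₁⊆H) , ⊆-∩⁺ X⊆H C₁₂.X⊆Eᵦ)
    ...   | inj₂ E₂⊆H = inj₂ (inj₁
      (E₂⊆H , M₁.maximal⇒hyperplane (C₂₁.maximal-⊇Eₐ⇒maximal-∩ᵦ maxH E₂⊆H) , ⊆-∩⁺ X⊆H C₁₂.X⊆Eₐ))
    maximal⇒cases {H = H} maxH | no X⊈H with ⊈⇒∃∉ X⊈H | nonempty? (H ∩ X)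
    ... | y , y∈X , y∉H | yes (x , x∈H∩X) = inj₂ (inj₂ (inj₁
      ( M₁.maximal⇒hyperplane (C₁₂.maximal-splitting-X⇒maximal-∩ₐ line₁ maxH x∈H x∈X y∈X y∉H)
      , M₂.maximal⇒hyperplane (C₂₁.maximal-splitting-X⇒maximal-∩ₐ line₂ maxH x∈H x∈X y∈X y∉H)
      , C₁₂.splitting-X⇒∣∩X∣≡1 line₁ (C₁₂.flat-∩ₐ (isFlat maxH)) x∈H x∈X y∈X y∉H )))
      where
      x∈H = ∈-∩⁻ˡ x∈H∩X
      x∈X = ∈-∩⁻ʳ x∈H∩X
    ... | _ | no H∩X-empty = inj₂ (inj₂ (inj₂
      ( M₁.maximal⇒hyperplane (C₁₂.maximal-disjoint-X⇒maximal-∩ₐ line₂ mod₂ line₁ maxH H∩X-empty)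
      , Empty-⊆ (⊆-∩⁺ ∈-∩⁻ˡ (∈-∩⁻ʳ ∘ ∈-∩⁻ʳ)) H∩X-empty
      , C₁₂.maximal-disjoint-X⇒corank2-∩ᵦ line₂ mod₂ maxH H∩X-empty
      , Empty-⊆ (⊆-∩⁺ ∈-∩⁻ˡ (∈-∩⁻ʳ ∘ ∈-∩⁻ʳ)) H∩X-empty )))

    cases⇒maximal : H ⊆ E M₁ ∪ E M₂ → HyperplaneCases M₁ M₂ X H → IsMaximalFlat P H
    cases⇒maximal H⊆E (inj₁ (E₁⊆H , hyp₂ , _)) =
      C₁₂.maximal-∩ᵦ-⊇Eₐ⇒maximal (C₁₂.⊆-E H⊆E) E₁⊆H (M₂.hyperplane⇒maximal hyp₂)
    cases⇒maximal H⊆E (inj₂ (inj₁ (E₂⊆H , hyp₁ , _))) =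
      C₂₁.maximal-∩ᵦ-⊇Eₐ⇒maximal (C₁₂.⊆-E H⊆E) E₂⊆H (M₁.hyperplane⇒maximal hyp₁)
    cases⇒maximal {H = H} H⊆E (inj₂ (inj₂ (inj₁ (hyp₁ , hyp₂ , ∣H∩X∣≡1)))) =
      C₁₂.maximal-parts⇒maximal (C₁₂.⊆-E H⊆E)
        (M₁.hyperplane⇒maximal hyp₁) (M₂.hyperplane⇒maximal hyp₂) X⊈H
      where
      X⊈H : ¬ X ⊆ H
      X⊈H X⊆H = ℕ.<⇒≱ (ℕ.≤-refl {2}) (begin
        2             ≤⟨ SimpleLine.2≤∣X∣ line₂ ⟩
        ∣ X ∣         ≤⟨ SP.p⊆q⇒∣p∣≤∣q∣ (⊆-∩⁺ X⊆H id) ⟩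
        ∣ H ∩ X ∣     ≡⟨ ∣H∩X∣≡1 ⟩
        1             ∎)
        where open ℕ.≤-Reasoning
    cases⇒maximal H⊆E (inj₂ (inj₂ (inj₂ (hyp₁ , H∩E₁∩X-empty , corank₂ , _)))) =
      C₁₂.disjoint-X-parts⇒maximal line₂ mod₂ (C₁₂.⊆-E H⊆E) (M₁.hyperplane⇒maximal hyp₁) corank₂
        (Empty-⊆ (λ x∈ → ∈-∩⁺ (∈-∩⁻ˡ x∈) (∈-∩⁺ (C₁₂.X⊆Eₐ (∈-∩⁻ʳ x∈)) (∈-∩⁻ʳ x∈))) H∩E₁∩X-empty)

  hyperplane⇔cases : H ⊆ E M₁ ∪ E M₂ → Hyperplane P H ⇔ HyperplaneCases M₁ M₂ X H
  hyperplane⇔cases H⊆E =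
    mk⇔ (maximal⇒cases ∘ P.hyperplane⇒maximal) (P.maximal⇒hyperplane ∘ cases⇒maximal H⊆E)

proposition2p8 : ∀ {m : ℕ} (M₁ M₂ : Matroid m) (X : Subset m) (n : ℕ)
    → E M₁ ∩ E M₂ ≡ X
    → SameRestriction M₁ M₂ X
    → ModularFlat M₂ X
    → 2 ≤ n
    → RestrictionIsoUniform M₂ X 2 n
    → (P : Matroid m) → IsGenParallelConnection M₁ M₂ X P
    → (H : Subset m) → H ⊆ E M₁ ∪ E M₂
    → Hyperplane P H ⇔
        ((E M₁ ⊆ H × Hyperplane M₂ (H ∩ E M₂) × X ⊆ H ∩ E M₂)
        ⊎ (E M₂ ⊆ H × Hyperplane M₁ (H ∩ E M₁) × X ⊆ H ∩ E M₁)
        ⊎ (Hyperplane M₁ (H ∩ E M₁) × Hyperplane M₂ (H ∩ E M₂) × ∣ H ∩ X ∣ ≡ 1)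
        ⊎ (Hyperplane M₁ (H ∩ E M₁) × Empty (H ∩ E M₁ ∩ X)
           × Corank2Flat M₂ (H ∩ E M₂) × Empty (H ∩ E M₂ ∩ X)))
proposition2p8 M₁ M₂ X n E₁∩E₂≡X same mod₂ 2≤n iso P pc H H⊆E =
  Hyperplanes.hyperplane⇔cases {M₁ = M₁} {M₂} {P}
    E₁∩E₂≡X pc (isSimpleLine-restrict same line₂) line₂ mod₂ H⊆E
  where
  line₂ : IsSimpleLine M₂ X
  line₂ = uniform⇒isSimpleLine 2≤n iso
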